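{- Let $0\leq m<\ell$ be integers and let $a_1,\ldots,a_\ell$ be integers with $2\leq a_1\leq \cdots\leq a_m\leq a_{m+1}\leq\cdots\leq a_\ell$. Write $S_x=\sum_{i=1}^x a_i$. Suppose that (P1) $S_m\geq \sum_{i=1}^m 2^i$ (trivial when $m=0$), (P2) $S_\ell\geq \sum_{i=1}^\ell 2^i$, (P3) there are integers $0\leq k\leq \ell-m$ and $c\geq 4$ such that $a_{m+1}=\cdots=a_{m+k}=\lfloor c/2\rfloor$ and $a_{m+k+1}=\cdots=a_\ell=\lceil c/2\rceil$. Then $S_p\geq \sum_{i=1}^p 2^i$ for every integer $p$ with $m<p<\ell$. -}

module Defs where

open import Data.Nat using (ℕ; zero; suc; _+_; _^_)

-- S a x = a 1 + a 2 + ... + a x   (sequence indexed from 1; a 0 is never used)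
S : (ℕ → ℕ) → ℕ → ℕ
S a zero    = 0
S a (suc x) = S a x + a (suc x)

T : ℕ → ℕ
T zero    = 0
T (suc x) = T x + 2 ^ suc x

{-# OPTIONS --safe #-}
module Submission where

-- On (m, ℓ] the sequence a takes the value ⌊c/2⌋ and then ⌈c/2⌉, so it grows by at most one
-- from each index to the next, while 2^y doubles. Hence 2^y ≤ a y propagates downwards and
-- a y ≤ 2^y upwards through (m, ℓ]. If 2^(p+1) ≤ a (p+1), every term of (m, p] dominates
-- the corresponding power of two and S_p ≥ T_p follows from (P1); otherwise every term of
-- (p, ℓ] is dominated by it and S_p ≥ T_p follows from (P2).

open import Defs
open import Data.Nat using (ℕ; zero; suc; _+_; _^_; _≤_; _<_; _≤′_; ≤′-reflexive; ≤′-step; ⌊_/2⌋; ⌈_/2⌉; z≤n; s≤s; s≤s⁻¹; _≤?_)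
open import Data.Nat.Properties
open import Data.Product using (_×_; ∃-syntax; _,_)
open import Data.Sum using ([_,_]′)
open import Relation.Binary.PropositionalEquality using (_≡_; refl; sym; cong; subst₂)
open import Relation.Nullary using (yes; no)

⌈n/2⌉≤1+⌊n/2⌋ : ∀ n → ⌈ n /2⌉ ≤ suc ⌊ n /2⌋
⌈n/2⌉≤1+⌊n/2⌋ zero          = z≤n
⌈n/2⌉≤1+⌊n/2⌋ (suc zero)    = s≤s z≤n
⌈n/2⌉≤1+⌊n/2⌋ (suc (suc n)) = s≤s (⌈n/2⌉≤1+⌊n/2⌋ n)

2^n+2^n≡2^[1+n] : ∀ n → 2 ^ n + 2 ^ n ≡ 2 ^ suc n
2^n+2^n≡2^[1+n] n = cong (2 ^ n +_) (sym (+-identityʳ (2 ^ n)))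

2^[1+n]≤1+m⇒2^n≤m : ∀ n {m} → 2 ^ suc n ≤ suc m → 2 ^ n ≤ m
2^[1+n]≤1+m⇒2^n≤m n {m} h = s≤s⁻¹ (begin
  suc (2 ^ n)    ≤⟨ +-monoˡ-≤ (2 ^ n) (m^n>0 2 n) ⟩
  2 ^ n + 2 ^ n  ≡⟨ 2^n+2^n≡2^[1+n] n ⟩
  2 ^ suc n      ≤⟨ h ⟩
  suc m          ∎)
  where open ≤-Reasoning

m≤2^n⇒1+m≤2^[1+n] : ∀ n {m} → m ≤ 2 ^ n → suc m ≤ 2 ^ suc n
m≤2^n⇒1+m≤2^[1+n] n {m} h = begin
  suc m          ≤⟨ +-mono-≤ (m^n>0 2 n) h ⟩
  2 ^ n + 2 ^ n  ≡⟨ 2^n+2^n≡2^[1+n] n ⟩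
  2 ^ suc n      ∎
  where open ≤-Reasoning

m+n≤o+p⇒o≤n⇒m≤p : ∀ {m n o p} → m + n ≤ o + p → o ≤ n → m ≤ p
m+n≤o+p⇒o≤n⇒m≤p {m} {n} {o} {p} m+n≤o+p o≤n = +-cancelʳ-≤ n m p (begin
  m + n  ≤⟨ m+n≤o+p ⟩
  o + p  ≤⟨ +-monoˡ-≤ p o≤n ⟩
  n + p  ≡⟨ +-comm n p ⟩
  p + n  ∎)
  where open ≤-Reasoning

T≡S-2^ : ∀ x → T x ≡ S (2 ^_) x
T≡S-2^ zero    = refl
T≡S-2^ (suc x) = cong (_+ 2 ^ suc x) (T≡S-2^ x)

S-increment-mono : ∀ {f g : ℕ → ℕ} {m p} → m ≤′ p → (∀ y → m < y → y ≤ p → f y ≤ g y)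
  → S f p + S g m ≤ S f m + S g p
S-increment-mono (≤′-reflexive refl) _ = ≤-refl
S-increment-mono {f} {g} {m} (≤′-step {n = p} m≤′p) f≤g = begin
  S f p + f (suc p) + S g m      ≡⟨ +-assoc (S f p) (f (suc p)) (S g m) ⟩
  S f p + (f (suc p) + S g m)    ≡⟨ cong (S f p +_) (+-comm (f (suc p)) (S g m)) ⟩
  S f p + (S g m + f (suc p))    ≡⟨ +-assoc (S f p) (S g m) (f (suc p)) ⟨
  S f p + S g m + f (suc p)      ≤⟨ +-mono-≤ increments-mono (f≤g (suc p) m<1+p ≤-refl) ⟩
  S f m + S g p + g (suc p)      ≡⟨ +-assoc (S f m) (S g p) (g (suc p)) ⟩
  S f m + (S g p + g (suc p))    ∎
  where
  open ≤-Reasoning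
  m<1+p : m < suc p
  m<1+p = s≤s (≤′⇒≤ m≤′p)
  increments-mono : S f p + S g m ≤ S f m + S g p
  increments-mono = S-increment-mono m≤′p (λ y m<y y≤p → f≤g y m<y (m≤n⇒m≤1+n y≤p))

T≤S-forward : ∀ {a m p} → T m ≤ S a m → m ≤ p → (∀ y → m < y → y ≤ p → 2 ^ y ≤ a y)
  → T p ≤ S a p
T≤S-forward {a} {m} {p} Tm≤Sm m≤p 2^≤a = m+n≤o+p⇒o≤n⇒m≤p increments Tm≤Sm
  where
  increments : T p + S a m ≤ T m + S a p
  increments = subst₂ (λ Tp Tm → Tp + S a m ≤ Tm + S a p) (sym (T≡S-2^ p)) (sym (T≡S-2^ m))
    (S-increment-mono (≤⇒≤′ m≤p) 2^≤a)

T≤S-backward : ∀ {a p ℓ} → T ℓ ≤ S a ℓ → p ≤ ℓ → (∀ y → p < y → y ≤ ℓ → a y ≤ 2 ^ y)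
  → T p ≤ S a p
T≤S-backward {a} {p} {ℓ} Tℓ≤Sℓ p≤ℓ a≤2^ =
  m+n≤o+p⇒o≤n⇒m≤p (subst₂ _≤_ (+-comm (S a ℓ) (T p)) (+-comm (S a p) (T ℓ)) increments) Tℓ≤Sℓ
  where
  increments : S a ℓ + T p ≤ S a p + T ℓ
  increments = subst₂ (λ Tp Tℓ → S a ℓ + Tp ≤ S a p + Tℓ) (sym (T≡S-2^ p)) (sym (T≡S-2^ ℓ))
    (S-increment-mono (≤⇒≤′ p≤ℓ) a≤2^)

GrowsByAtMostOneOn : (ℕ → ℕ) → ℕ → ℕ → Set
GrowsByAtMostOneOn a m ℓ = ∀ y → m < y → suc y ≤ ℓ → a (suc y) ≤ suc (a y)

twoLevels-growsByAtMostOne : ∀ {a m n ℓ u v} → v ≤ suc u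
  → (∀ i → m < i → i ≤ n → a i ≡ u) → (∀ i → n < i → i ≤ ℓ → a i ≡ v)
  → GrowsByAtMostOneOn a m ℓ
twoLevels-growsByAtMostOne {a} {m} {n} {ℓ} {u} {v} v≤1+u low high y m<y y<ℓ
  with suc y ≤? n | y ≤? n
... | yes 1+y≤n | _ rewrite low (suc y) (m<n⇒m<1+n m<y) 1+y≤n | low y m<y (<⇒≤ 1+y≤n) = n≤1+n u
... | no 1+y≰n | yes y≤n rewrite high (suc y) (≰⇒> 1+y≰n) y<ℓ | low y m<y y≤n = v≤1+u
... | no 1+y≰n | no y≰n rewrite high (suc y) (≰⇒> 1+y≰n) y<ℓ | high y (≰⇒> y≰n) (<⇒≤ y<ℓ) = n≤1+n v

module _ {a : ℕ → ℕ} {m ℓ : ℕ} (grows : GrowsByAtMostOneOn a m ℓ) where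

  2^≤a-downward : ∀ {y z} → m < y → y ≤′ z → z ≤ ℓ → 2 ^ z ≤ a z → 2 ^ y ≤ a y
  2^≤a-downward m<y (≤′-reflexive refl) _ 2^≤a = 2^≤a
  2^≤a-downward m<y (≤′-step {n = z} y≤′z) 1+z≤ℓ 2^≤a =
    2^≤a-downward m<y y≤′z (<⇒≤ 1+z≤ℓ)
      (2^[1+n]≤1+m⇒2^n≤m z (≤-trans 2^≤a (grows z (<-≤-trans m<y (≤′⇒≤ y≤′z)) 1+z≤ℓ)))

  a≤2^-upward : ∀ {y z} → m < y → y ≤′ z → z ≤ ℓ → a y ≤ 2 ^ y → a z ≤ 2 ^ z
  a≤2^-upward m<y (≤′-reflexive refl) _ a≤2^ = a≤2^
  a≤2^-upward m<y (≤′-step {n = z} y≤′z) 1+z≤ℓ a≤2^ =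
    ≤-trans (grows z (<-≤-trans m<y (≤′⇒≤ y≤′z)) 1+z≤ℓ)
      (m≤2^n⇒1+m≤2^[1+n] z (a≤2^-upward m<y y≤′z (<⇒≤ 1+z≤ℓ) a≤2^))

lemma4 : (m ℓ : ℕ) → m < ℓ → (a : ℕ → ℕ)
    → (∀ i → 1 ≤ i → i ≤ ℓ → 2 ≤ a i)
    → (∀ i j → 1 ≤ i → i ≤ j → j ≤ ℓ → a i ≤ a j)
    → T m ≤ S a m
    → T ℓ ≤ S a ℓ
    → (∃[ k ] ∃[ c ] (m + k ≤ ℓ × 4 ≤ c
        × (∀ i → m < i → i ≤ m + k → a i ≡ ⌊ c /2⌋)
        × (∀ i → m + k < i → i ≤ ℓ → a i ≡ ⌈ c /2⌉)))
    → ∀ p → m < p → p < ℓ → T p ≤ S a p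
lemma4 m ℓ _ a _ _ Tm≤Sm Tℓ≤Sℓ (k , c , _ , _ , low , high) p m<p p<ℓ =
  [ forward , backward ]′ (≤-<-connex (2 ^ suc p) (a (suc p)))
  where
  grows : GrowsByAtMostOneOn a m ℓ
  grows = twoLevels-growsByAtMostOne (⌈n/2⌉≤1+⌊n/2⌋ c) low high

  forward : 2 ^ suc p ≤ a (suc p) → T p ≤ S a p
  forward 2^≤a = T≤S-forward Tm≤Sm (<⇒≤ m<p) λ y m<y y≤p →
    2^≤a-downward grows m<y (≤⇒≤′ (m≤n⇒m≤1+n y≤p)) p<ℓ 2^≤a

  backward : a (suc p) < 2 ^ suc p → T p ≤ S a p
  backward a<2^ = T≤S-backward Tℓ≤Sℓ (<⇒≤ p<ℓ) λ y p<y y≤ℓ →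
    a≤2^-upward grows (m<n⇒m<1+n m<p) (≤⇒≤′ p<y) y≤ℓ (<⇒≤ a<2^)
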